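{- Let $\alpha\in\mathbb{N}$. For $n\in\mathbb{N}$ let $r(n,\alpha)$ denote the number of pairs $(x,y)\in\mathbb{Z}^2$ with $n=x^2+\alpha y^2$. Then for every $n\in\mathbb{N}$, $$r(n,\alpha)\le 6\,\tau(n)^2,$$ where $\tau(n)$ is the number of positive divisors of $n$. -}

module Defs where

open import Data.Nat using (ℕ; suc; _+_; _*_)
open import Data.Nat.Divisibility using (_∣?_)
open import Data.Integer as ℤ using (ℤ; +_; _-_)
open import Data.Integer.Properties using () renaming (_≟_ to _≟ℤ_)
open import Data.List using (List; length; filter; map; upTo; cartesianProduct)
open import Data.Product using (_×_; _,_)

window : ℕ → List ℤ
window n = map (λ i → + i - + n) (upTo (suc (n + n)))

-- r(n, α) = #{(x, y) ∈ ℤ² : n = x² + α y²}.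
-- Any solution with α ≥ 1 satisfies x² ≤ n and y² ≤ n, hence |x|, |y| ≤ n,
-- so counting inside the window [-n, n]² counts all integer solutions.
r : ℕ → ℕ → ℕ
r n α = length (filter (λ p → (+ n) ≟ℤ (sq (Data.Product.proj₁ p) ℤ.+ (+ α) ℤ.* sq (Data.Product.proj₂ p)))
                       (cartesianProduct (window n) (window n)))
  where
  sq : ℤ → ℤ
  sq z = z ℤ.* z

-- τ(n) = number of positive divisors of n (for n ≥ 1 all lie in 1..n).
τ : ℕ → ℕ
τ n = length (filter (λ d → d ∣? n) (map suc (upTo n)))

module Submission where

-- Write α = d f² with d square-free and put (X , Y) = (x , f y), so that n = X² + d Y². A solution
-- is g times a primitive representation v = X₁ + Y₁√-d of m = n / g², where g = gcd(X , Y). Fix for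
-- every g one primitive representation p of m and attach to the solution the code (g , e) with
-- e = gcd(m , Im(v p̄)); both entries divide n, so there are at most τ(n)² codes. If v′ has the same
-- code as v, then ζ = v′ v̄ is divisible by e (through p̄) and by m / e (through p), hence by
-- l = lcm(e , m / e). With k = gcd(e , m / e) = m / l this gives k v′ = w v for w = ζ / l of norm k².
-- Finally k² ∣ 4d, so k ∈ {1 , 2} as d is square-free, and at most 6 elements of ℤ[√-d] have norm
-- k², so every code is shared by at most 6 solutions.

open import Data.Nat using (ℕ)

module Lists where

  open import Data.Nat using (suc; _+_; _*_; _≤_; z≤n; s≤s)
  open import Data.Nat.Properties using (+-suc; +-mono-≤; ≤-trans; *-suc)
  open import Data.List using (List; []; _∷_; _++_; length; filter; map; head; cartesianProduct)
  open import Data.List.Properties using (length-++; length-map)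
  open import Data.List.Membership.Propositional using (_∈_)
  open import Data.List.Membership.Propositional.Properties using (∈-∃++; ∈-++⁻; ∈-++⁺ˡ; ∈-++⁺ʳ; ∈-filter⁻)
  open import Data.List.Relation.Binary.Subset.Propositional using (_⊆_)
  open import Data.List.Relation.Unary.Any using (here; there)
  open import Data.List.Relation.Unary.AllPairs using (_∷_)
  open import Data.List.Relation.Unary.Unique.Propositional using (Unique)
  open import Data.List.Relation.Unary.Unique.Propositional.Properties using (filter⁺; Unique[x∷xs]⇒x∉xs)
  open import Data.Maybe using (just)
  open import Data.Product using (∃-syntax; _×_; _,_; proj₁)
  open import Data.Sum using (inj₁; inj₂)
  open import Relation.Binary.Definitions using (DecidableEquality)
  open import Relation.Binary.PropositionalEquality using (_≡_; refl; sym; trans; cong; cong₂; subst; subst₂)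
  open import Relation.Nullary using (yes; no)
  open import Relation.Nullary.Negation using (contradiction)
  open import Relation.Unary using (Decidable)
  open import Relation.Unary.Properties using (∁?)

  private variable
    A B : Set
    xs ys : List A

  length-cartesianProduct : (xs : List A) (ys : List B) →
                            length (cartesianProduct xs ys) ≡ length xs * length ys
  length-cartesianProduct [] ys = refl
  length-cartesianProduct (x ∷ xs) ys =
    trans (length-++ (map (x ,_) ys)) (cong₂ _+_ (length-map (x ,_) ys) (length-cartesianProduct xs ys))

  ∈⇒head≡just : ∀ {x : A} → x ∈ xs → ∃[ y ] head xs ≡ just y × y ∈ xs
  ∈⇒head≡just {xs = y ∷ _} _ = y , refl , here refl

  length-filter+filter-∁ : ∀ {P : A → Set} (P? : Decidable P) xs →
                           length (filter P? xs) + length (filter (∁? P?) xs) ≡ length xs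
  length-filter+filter-∁ P? [] = refl
  length-filter+filter-∁ P? (x ∷ xs) with P? x
  ... | yes _ = cong suc (length-filter+filter-∁ P? xs)
  ... | no _ = trans (+-suc _ _) (cong suc (length-filter+filter-∁ P? xs))

  Unique⇒length≤ : Unique xs → xs ⊆ ys → length xs ≤ length ys
  Unique⇒length≤ {xs = []} _ _ = z≤n
  Unique⇒length≤ {xs = x ∷ xs} x∷xs!@(_ ∷ xs!) x∷xs⊆ys with as , bs , refl ← ∈-∃++ (x∷xs⊆ys (here refl)) =
    subst (suc (length xs) ≤_) (sym length-as++x∷bs) (s≤s (Unique⇒length≤ xs! xs⊆as++bs))
    where
    length-as++x∷bs : length (as ++ x ∷ bs) ≡ suc (length (as ++ bs))
    length-as++x∷bs = trans (length-++ as) (trans (+-suc (length as) (length bs)) (cong suc (sym (length-++ as))))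
    xs⊆as++bs : xs ⊆ as ++ bs
    xs⊆as++bs z∈xs with ∈-++⁻ as (x∷xs⊆ys (there z∈xs))
    ... | inj₁ z∈as = ∈-++⁺ˡ z∈as
    ... | inj₂ (here refl) = contradiction z∈xs (Unique[x∷xs]⇒x∉xs x∷xs!)
    ... | inj₂ (there z∈bs) = ∈-++⁺ʳ as z∈bs

  length≤-covered : ∀ {K} → Unique xs → (∀ {x} → x ∈ xs → ∃[ L ] length L ≤ K × xs ⊆ L) → length xs ≤ K
  length≤-covered {xs = []} _ _ = z≤n
  length≤-covered {xs = _ ∷ _} xs! cover with L , |L|≤K , xs⊆L ← cover (here refl) =
    ≤-trans (Unique⇒length≤ xs! xs⊆L) |L|≤K

  length≤-fibres : ∀ {K} (f : A → B) (_≟_ : DecidableEquality B) (cs : List B) →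
                   Unique xs → (∀ {x} → x ∈ xs → f x ∈ cs) →
                   (∀ {x} → x ∈ xs → ∃[ L ] length L ≤ K × (∀ {y} → y ∈ xs → f y ≡ f x → y ∈ L)) →
                   length xs ≤ K * length cs
  length≤-fibres {xs = []} f _≟_ cs _ _ _ = z≤n
  length≤-fibres {xs = _ ∷ _} f _≟_ [] _ f∈cs _ with () ← f∈cs (here refl)
  length≤-fibres {xs = xs} {K} f _≟_ (c ∷ cs) xs! f∈c∷cs fibre =
    subst₂ _≤_ (length-filter+filter-∁ P? xs) (sym (*-suc K (length cs)))
      (+-mono-≤ (length≤-covered (filter⁺ P? xs!) cover)
                (length≤-fibres f _≟_ cs (filter⁺ (∁? P?) xs!) f∈cs fibre′))
    where
    P? : Decidable (λ x → f x ≡ c)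
    P? x = f x ≟ c
    cover : ∀ {x} → x ∈ filter P? xs → ∃[ L ] length L ≤ K × filter P? xs ⊆ L
    cover x∈ with x∈xs , fx≡c ← ∈-filter⁻ P? x∈ with L , |L|≤K , fibre-x⊆L ← fibre x∈xs =
      L , |L|≤K , λ y∈ → let y∈xs , fy≡c = ∈-filter⁻ P? y∈ in fibre-x⊆L y∈xs (trans fy≡c (sym fx≡c))
    f∈cs : ∀ {x} → x ∈ filter (∁? P?) xs → f x ∈ cs
    f∈cs x∈ with x∈xs , fx≢c ← ∈-filter⁻ (∁? P?) x∈ with f∈c∷cs x∈xs
    ... | here fx≡c = contradiction fx≡c fx≢c
    ... | there fx∈cs = fx∈cs
    fibre′ : ∀ {x} → x ∈ filter (∁? P?) xs →
             ∃[ L ] length L ≤ K × (∀ {y} → y ∈ filter (∁? P?) xs → f y ≡ f x → y ∈ L)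
    fibre′ x∈ with L , |L|≤K , fibre-x⊆L ← fibre (proj₁ (∈-filter⁻ (∁? P?) x∈)) =
      L , |L|≤K , λ y∈ → fibre-x⊆L (proj₁ (∈-filter⁻ (∁? P?) y∈))


module Naturals where

  open import Data.Nat using (ℕ; zero; suc; _+_; _*_; _<_; _≤?_; NonZero; ≢-nonZero; ≢-nonZero⁻¹; z≤n; s≤s)
  open import Data.Nat.Induction using (<-rec)
  open import Data.Nat.Properties
    using (<-cmp; <⇒≢; *-mono-<; +-comm; *-comm; *-identityˡ; *-identityʳ; m*n≢0; m*n≢0⇒m≢0; ≤-trans; m≤m*n; m<m*n; anyUpTo?)
  open import Data.Nat.Divisibility
  open import Data.Nat.DivMod using (_/_; m/n*n≡m; *-/-assoc)
  open import Data.Nat.GCD using (gcd; gcd[m,n]∣m; gcd[m,n]∣n; gcd[m,n]≢0)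
  open import Data.Nat.Coprimality using (Coprime; coprime-divisor; coprime-/gcd) renaming (sym to coprime-sym)
  open import Data.Nat.Primality using (irreducible[2])
  open import Data.Nat.Tactic.RingSolver using (solve-∀)
  open import Data.Product using (∃₂; _×_; _,_)
  open import Data.Sum using (_⊎_; inj₁; inj₂)
  open import Function using (it)
  open import Relation.Binary.Definitions using (tri<; tri≈; tri>)
  open import Relation.Binary.PropositionalEquality using (_≡_; refl; sym; trans; cong; subst; subst₂)
  open import Relation.Nullary using (¬_; yes; no)
  open import Relation.Nullary.Decidable using (_×-dec_)
  open import Relation.Nullary.Negation using (contradiction)

  private variable a b c d k x y : ℕ

  coprime-∣ˡ : c ∣ a → Coprime a b → Coprime c b
  coprime-∣ˡ c∣a a⊥b (x∣c , x∣b) = a⊥b (∣-trans x∣c c∣a , x∣b)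

  coprime-*ʳ : Coprime a b → Coprime a c → Coprime a (b * c)
  coprime-*ʳ a⊥b a⊥c (x∣a , x∣b*c) = a⊥c (x∣a , coprime-divisor (coprime-∣ˡ x∣a a⊥b) x∣b*c)

  coprime-square : Coprime a b → Coprime (a * a) (b * b)
  coprime-square {a} {b} a⊥b = coprime-*ʳ a*a⊥b a*a⊥b
    where
    a*a⊥b : Coprime (a * a) b
    a*a⊥b = coprime-sym (coprime-*ʳ (coprime-sym a⊥b) (coprime-sym a⊥b))

  coprime[2,odd] : ¬ (2 ∣ k) → Coprime 2 k
  coprime[2,odd] 2∤k (x∣2 , x∣k) with irreducible[2] x∣2
  ... | inj₁ x≡1 = x≡1
  ... | inj₂ refl = contradiction x∣k 2∤k

  m*m≡n*n⇒m≡n : ∀ m n → m * m ≡ n * n → m ≡ n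
  m*m≡n*n⇒m≡n m n eq with <-cmp m n
  ... | tri< m<n _ _ = contradiction eq (<⇒≢ (*-mono-< m<n m<n))
  ... | tri≈ _ m≡n _ = m≡n
  ... | tri> _ _ n<m = contradiction (sym eq) (<⇒≢ (*-mono-< n<m n<m))

  m*m∣n*n⇒m∣n : ∀ m n → m * m ∣ n * n → m ∣ n
  m*m∣n*n⇒m∣n zero zero _ = ∣-refl
  m*m∣n*n⇒m∣n zero (suc n) 0∣n*n with () ← 0∣⇒≡0 0∣n*n
  m*m∣n*n⇒m∣n m@(suc _) n m*m∣n*n = subst (_∣ n) g≡m (gcd[m,n]∣n m n)
    where
    g : ℕ
    g = gcd m n
    instance
      g≢0 : NonZero g
      g≢0 = ≢-nonZero (gcd[m,n]≢0 m n (inj₁ λ ()))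
      g*g≢0 : NonZero (g * g)
      g*g≢0 = m*n≢0 g g
    m′ n′ : ℕ
    m′ = m / g
    n′ = n / g
    square-/ : ∀ {x} → g ∣ x → x * x ≡ (g * g) * ((x / g) * (x / g))
    square-/ {x} g∣x = trans (cong (λ t → t * t) (sym (m/n*n≡m g∣x))) (regroup (x / g) g)
      where
      regroup : ∀ a g → (a * g) * (a * g) ≡ (g * g) * (a * a)
      regroup = solve-∀
    m′*m′∣n′*n′ : m′ * m′ ∣ n′ * n′
    m′*m′∣n′*n′ = *-cancelˡ-∣ (g * g) (subst₂ _∣_ (square-/ (gcd[m,n]∣m m n)) (square-/ (gcd[m,n]∣n m n)) m*m∣n*n)
    m′≡1 : m′ ≡ 1
    m′≡1 = coprime-/gcd m n (∣-refl , coprime-divisor (coprime-/gcd m n) (m*n∣⇒m∣ m′ m′ m′*m′∣n′*n′))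
    g≡m : g ≡ m
    g≡m = trans (sym (*-identityˡ g)) (trans (cong (_* g) (sym m′≡1)) (m/n*n≡m (gcd[m,n]∣m m n)))

  /gcd-∣ : ∀ {m b c g} .{{_ : NonZero g}} → gcd m b ≡ g → m ∣ b * c → m / g ∣ c
  /gcd-∣ {m} {b} {c} refl m∣b*c = coprime-divisor (coprime-/gcd m b) m/g∣b/g*c
    where
    g : ℕ
    g = gcd m b
    m/g*g∣c*b : m / g * g ∣ c * b
    m/g*g∣c*b = subst₂ _∣_ (sym (m/n*n≡m (gcd[m,n]∣m m b))) (*-comm b c) m∣b*c
    m/g∣b/g*c : m / g ∣ b / g * c
    m/g∣b/g*c = subst (m / g ∣_) (trans (*-/-assoc c (gcd[m,n]∣n m b)) (*-comm c (b / g)))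
                  (m*n∣o⇒m∣o/n (m / g) g m/g*g∣c*b)

  coprime-sumOfSquares : ∀ d → Coprime a b → Coprime b (a * a + d * (b * b))
  coprime-sumOfSquares {a} {b} d a⊥b {c} (c∣b , c∣N) = a⊥b (c∣a , c∣b)
    where
    c∣a*a : c ∣ a * a
    c∣a*a = ∣m+n∣m⇒∣n (subst (c ∣_) (+-comm (a * a) _) c∣N) (∣n⇒∣m*n d (∣m⇒∣m*n b c∣b))
    c∣a : c ∣ a
    c∣a = coprime-divisor (coprime-∣ˡ c∣b (coprime-sym a⊥b)) c∣a*a

  ∣-sumOfSquares : ∀ {m} d → m * m ≡ a * a + d * (b * b) → c ∣ m → c ∣ b → c ∣ a
  ∣-sumOfSquares {a} {b} {c} d m*m≡N c∣m c∣b = m*m∣n*n⇒m∣n c a c*c∣a*a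
    where
    c*c∣a*a : c * c ∣ a * a
    c*c∣a*a = ∣m+n∣m⇒∣n (subst (c * c ∣_) (trans m*m≡N (+-comm (a * a) _)) (*-pres-∣ c∣m c∣m))
                        (∣n⇒∣m*n d (*-pres-∣ c∣b c∣b))

  square∣sumOfSquares⇒square∣4* : ∀ d → Coprime k y → k ∣ 2 * x → k * k ∣ x * x + d * (y * y) → k * k ∣ 4 * d
  square∣sumOfSquares⇒square∣4* {k} {y} {x} d k⊥y k∣2x k*k∣N = coprime-divisor (coprime-square k⊥y) k*k∣y*y*4d
    where
    expand : ∀ x y d → 4 * (x * x + d * (y * y)) ≡ (2 * x) * (2 * x) + (y * y) * (4 * d)
    expand = solve-∀
    k*k∣y*y*4d : k * k ∣ (y * y) * (4 * d)
    k*k∣y*y*4d = ∣m+n∣m⇒∣n (subst (k * k ∣_) (expand x y d) (∣n⇒∣m*n 4 k*k∣N)) (*-pres-∣ k∣2x k∣2x)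

  SquareFree : ℕ → Set
  SquareFree d = ∀ j → j * j ∣ d → j ≡ 1

  k*k∣4*d⇒k≡1∨k≡2 : SquareFree d → k * k ∣ 4 * d → k ≡ 1 ⊎ k ≡ 2
  k*k∣4*d⇒k≡1∨k≡2 {d} {k} d-sqf k*k∣4d with 2 ∣? k
  ... | yes (divides j refl) = inj₂ (cong (_* 2) (d-sqf j (*-cancelˡ-∣ 4 (subst (_∣ 4 * d) (regroup j) k*k∣4d))))
    where
    regroup : ∀ j → (j * 2) * (j * 2) ≡ 4 * (j * j)
    regroup = solve-∀
  ... | no 2∤k = inj₁ (d-sqf k (coprime-divisor (coprime-sym (coprime-square (coprime[2,odd] 2∤k))) k*k∣4d))

  squareFree-decomposition : ∀ α → .{{NonZero α}} → ∃₂ λ d f → α ≡ d * (f * f) × SquareFree d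
  squareFree-decomposition = <-rec _ decompose
    where
    decompose : ∀ α → (∀ {β} → β < α → .{{NonZero β}} → ∃₂ λ d f → β ≡ d * (f * f) × SquareFree d) →
                .{{NonZero α}} → ∃₂ λ d f → α ≡ d * (f * f) × SquareFree d
    decompose α rec with anyUpTo? (λ j → 2 ≤? j ×-dec j * j ∣? α) (suc α)
    ... | yes (j , _ , 2≤j@(s≤s (s≤s _)) , divides q α≡q*j*j) =
      let d , f , q≡d*f*f , d-sqf = rec q<α
      in d , f * j , trans α≡q*j*j (trans (cong (_* (j * j)) q≡d*f*f) (regroup d f j)) , d-sqf
      where
      regroup : ∀ d f j → d * (f * f) * (j * j) ≡ d * ((f * j) * (f * j))
      regroup = solve-∀
      instance
        q≢0 : NonZero q
        q≢0 = m*n≢0⇒m≢0 q {{subst NonZero α≡q*j*j it}}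
      q<α : q < α
      q<α = subst (q <_) (sym α≡q*j*j) (m<m*n q (j * j) (≤-trans 2≤j (m≤m*n j j)))
    ... | no ¬square∣α = α , 1 , sym (*-identityʳ α) , α-sqf
      where
      α-sqf : SquareFree α
      α-sqf zero 0∣α = contradiction (0∣⇒≡0 0∣α) (≢-nonZero⁻¹ α)
      α-sqf (suc zero) _ = refl
      α-sqf j@(suc (suc _)) j*j∣α =
        contradiction (j , s≤s (≤-trans (m≤m*n j j) (∣⇒≤ j*j∣α)) , s≤s (s≤s z≤n) , j*j∣α) ¬square∣α

module Integers where

  open import Data.Nat as ℕ using (ℕ; zero; suc; NonZero)
  open import Data.Nat.Divisibility as ℕ using (m∣m*n; 0∣⇒≡0)
  open import Data.Nat.DivMod using (_/_; m*[n/m]≡n)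
  open import Data.Nat.Coprimality using (Coprime; coprime-divisor)
  open import Data.Integer using (ℤ; +_; _*_; ∣_∣; sign; _◃_)
  open import Data.Integer.Divisibility.Signed using (_∣_; ∣ᵤ⇒∣; ∣⇒∣ᵤ)
  open import Data.Integer.Properties using (abs-◃; ◃-inverse; ◃-distrib-*; +◃n≡+n; abs-*; ∣i∣≡0⇒i≡0; *-cancelˡ-≡)
  import Data.Sign.Base as Sign
  open import Relation.Binary.PropositionalEquality using (_≡_; sym; cong; subst; module ≡-Reasoning)

  infixl 7 _÷_

  -- Divides ∣ z ∣ and keeps the sign of z, so it is exact when k ∣ ∣ z ∣; z ÷ 0 = + 0 is junk.
  _÷_ : ℤ → ℕ → ℤ
  z ÷ zero = + 0
  z ÷ suc k = sign z ◃ (∣ z ∣ / suc k)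

  ÷-exact : ∀ {k} z → k ℕ.∣ ∣ z ∣ → + k * (z ÷ k) ≡ z
  ÷-exact {zero} z 0∣z = sym (∣i∣≡0⇒i≡0 (0∣⇒≡0 0∣z))
  ÷-exact {suc k} z k∣z = begin
    + suc k * (sign z ◃ (∣ z ∣ / suc k))          ≡⟨ cong (_* (sign z ◃ (∣ z ∣ / suc k))) (sym (+◃n≡+n (suc k))) ⟩
    (Sign.+ ◃ suc k) * (sign z ◃ (∣ z ∣ / suc k)) ≡⟨ sym (◃-distrib-* Sign.+ (sign z) (suc k) _) ⟩
    sign z ◃ (suc k ℕ.* (∣ z ∣ / suc k))          ≡⟨ cong (sign z ◃_) (m*[n/m]≡n k∣z) ⟩
    sign z ◃ ∣ z ∣                                ≡⟨ ◃-inverse z ⟩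
    z                                             ∎
    where open ≡-Reasoning

  abs-÷ : ∀ k .{{_ : NonZero k}} z → ∣ z ÷ k ∣ ≡ ∣ z ∣ / k
  abs-÷ (suc k) z = abs-◃ (sign z) (∣ z ∣ / suc k)

  *-÷ : ∀ k .{{_ : NonZero k}} z → (+ k * z) ÷ k ≡ z
  *-÷ k z = *-cancelˡ-≡ (+ k) _ _ (÷-exact (+ k * z) (subst (k ℕ.∣_) (sym (abs-* (+ k) z)) (m∣m*n ∣ z ∣)))

  coprime-∣-cancelˡ : ∀ {c a b} → Coprime c ∣ a ∣ → + c ∣ a * b → + c ∣ b
  coprime-∣-cancelˡ {c} {a} {b} c⊥a c∣a*b =
    ∣ᵤ⇒∣ (coprime-divisor c⊥a (subst (c ℕ.∣_) (abs-* a b) (∣⇒∣ᵤ c∣a*b)))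

-- (x , y) stands for x + y√-d: _·_ is the multiplication of ℤ[√-d] and norm its norm form.
module ℤ[√-d] (d : ℕ) where

  open Naturals using (coprime-∣ˡ; /gcd-∣; ∣-sumOfSquares; square∣sumOfSquares⇒square∣4*)
  open Integers using (_÷_; ÷-exact; coprime-∣-cancelˡ)

  open import Data.Nat as ℕ using (NonZero)
  import Data.Nat.Properties as ℕ
  open import Data.Nat.Divisibility as ℕ using (m/n∣m)
  open import Data.Nat.DivMod using (_/_; m*[n/m]≡n)
  open import Data.Nat.GCD using (gcd; gcd[m,n]∣m; gcd[m,n]∣n; gcd[m,n]≢0)
  open import Data.Nat.LCM using (lcm; lcm-least; gcd*lcm)
  open import Data.Nat.Coprimality using (Coprime) renaming (sym to coprime-sym)
  import Data.Nat.Tactic.RingSolver as ℕ-Solver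
  open import Data.Integer using (ℤ; +_; -[1+_]; _+_; _*_; _-_; -_; ∣_∣)
  open import Data.Integer.Divisibility.Signed as ℤ using (_∣_; ∣ᵤ⇒∣; ∣⇒∣ᵤ)
  open import Data.Integer.Properties
    using (+-injective; +◃n≡+n; abs-*; pos-*; pos-+; *-cancelˡ-≡; *-assoc; *-comm; ∣-i∣≡∣i∣)
  open import Data.Integer.Tactic.RingSolver using (solve-∀)
  open import Data.Product using (∃-syntax; _×_; _,_; proj₁; proj₂)
  open import Data.Sum using (inj₁)
  open import Relation.Binary.PropositionalEquality

  infixl 7 _·_
  infixr 7 _*ₗ_

  ℤ² : Set
  ℤ² = ℤ × ℤ

  re im : ℤ² → ℤ
  re (x , _) = x
  im (_ , y) = y

  norm : ℤ² → ℤ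
  norm (x , y) = x * x + + d * (y * y)

  normℕ : ℤ² → ℕ
  normℕ (x , y) = ∣ x ∣ ℕ.* ∣ x ∣ ℕ.+ d ℕ.* (∣ y ∣ ℕ.* ∣ y ∣)

  _·_ : ℤ² → ℤ² → ℤ²
  (a , b) · (x , y) = (a * x - + d * (b * y) , a * y + b * x)

  conj : ℤ² → ℤ²
  conj (x , y) = (x , - y)

  _*ₗ_ : ℤ → ℤ² → ℤ²
  c *ₗ (x , y) = (c * x , c * y)

  norm≡normℕ : ∀ v → norm v ≡ + normℕ v
  norm≡normℕ (x , y) = begin
    x * x + + d * (y * y)                              ≡⟨ cong₂ (λ s t → s + + d * t) (square x) (square y) ⟩
    + (∣ x ∣ ℕ.* ∣ x ∣) + + d * + (∣ y ∣ ℕ.* ∣ y ∣)    ≡⟨ cong (λ t → + (∣ x ∣ ℕ.* ∣ x ∣) + t) (sym (pos-* d _)) ⟩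
    + (∣ x ∣ ℕ.* ∣ x ∣) + + (d ℕ.* (∣ y ∣ ℕ.* ∣ y ∣)) ≡⟨ sym (pos-+ (∣ x ∣ ℕ.* ∣ x ∣) _) ⟩
    + normℕ (x , y)                                    ∎
    where
    open ≡-Reasoning
    square : ∀ z → z * z ≡ + (∣ z ∣ ℕ.* ∣ z ∣)
    square (+ n) = +◃n≡+n (n ℕ.* n)
    square -[1+ n ] = refl

  norm-· : ∀ u v → norm (u · v) ≡ norm u * norm v
  norm-· (a , b) (x , y) = brahmagupta (+ d) a b x y
    where
    brahmagupta : ∀ D a b x y → (a * x - D * (b * y)) * (a * x - D * (b * y)) + D * ((a * y + b * x) * (a * y + b * x))
                                ≡ (a * a + D * (b * b)) * (x * x + D * (y * y))
    brahmagupta = solve-∀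

  norm-conj : ∀ v → norm (conj v) ≡ norm v
  norm-conj (x , y) = cong (λ t → x * x + + d * t) (neg-square y)
    where
    neg-square : ∀ y → - y * - y ≡ y * y
    neg-square = solve-∀

  norm-*ₗ : ∀ c v → norm (c *ₗ v) ≡ c * c * norm v
  norm-*ₗ c (x , y) = identity (+ d) c x y
    where
    identity : ∀ D c x y → c * x * (c * x) + D * (c * y * (c * y)) ≡ c * c * (x * x + D * (y * y))
    identity = solve-∀

  ·-conj-· : ∀ v′ v → (v′ · conj v) · v ≡ norm v *ₗ v′
  ·-conj-· (x′ , y′) (x , y) = cong₂ _,_ (identity₁ (+ d) x y x′ y′) (identity₂ (+ d) x y x′ y′)
    where
    identity₁ : ∀ D x y x′ y′ →
                (x′ * x - D * (y′ * - y)) * x - D * ((x′ * - y + y′ * x) * y) ≡ (x * x + D * (y * y)) * x′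
    identity₁ = solve-∀
    identity₂ : ∀ D x y x′ y′ → (x′ * x - D * (y′ * - y)) * y + (x′ * - y + y′ * x) * x ≡ (x * x + D * (y * y)) * y′
    identity₂ = solve-∀

  *ₗ-· : ∀ c w v → (c *ₗ w) · v ≡ c *ₗ (w · v)
  *ₗ-· c (a , b) (x , y) = cong₂ _,_ (identity₁ (+ d) c a b x y) (identity₂ c a b x y)
    where
    identity₁ : ∀ D c a b x y → c * a * x - D * (c * b * y) ≡ c * (a * x - D * (b * y))
    identity₁ = solve-∀
    identity₂ : ∀ c a b x y → c * a * y + c * b * x ≡ c * (a * y + b * x)
    identity₂ = solve-∀

  ·-*ₗ : ∀ c w v → w · (c *ₗ v) ≡ c *ₗ (w · v)
  ·-*ₗ c (a , b) (x , y) = cong₂ _,_ (identity₁ (+ d) c a b x y) (identity₂ c a b x y)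
    where
    identity₁ : ∀ D c a b x y → a * (c * x) - D * (b * (c * y)) ≡ c * (a * x - D * (b * y))
    identity₁ = solve-∀
    identity₂ : ∀ c a b x y → a * (c * y) + b * (c * x) ≡ c * (a * y + b * x)
    identity₂ = solve-∀

  *ₗ-*ₗ : ∀ a b v → a *ₗ b *ₗ v ≡ (a * b) *ₗ v
  *ₗ-*ₗ a b (x , y) = cong₂ _,_ (sym (*-assoc a b x)) (sym (*-assoc a b y))

  *ₗ-cancel : ∀ c .{{_ : NonZero c}} {v w} → + c *ₗ v ≡ + c *ₗ w → v ≡ w
  *ₗ-cancel c {x , y} {x′ , y′} eq =
    cong₂ _,_ (*-cancelˡ-≡ (+ c) x x′ (cong re eq)) (*-cancelˡ-≡ (+ c) y y′ (cong im eq))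

  *ₗ-ratio : ∀ c k w v v′ → k *ₗ v′ ≡ w · v → k *ₗ c *ₗ v′ ≡ w · (c *ₗ v)
  *ₗ-ratio c k w v v′ k*v′≡w·v = begin
    k *ₗ c *ₗ v′    ≡⟨ *ₗ-*ₗ k c v′ ⟩
    (k * c) *ₗ v′   ≡⟨ cong (_*ₗ v′) (*-comm k c) ⟩
    (c * k) *ₗ v′   ≡⟨ sym (*ₗ-*ₗ c k v′) ⟩
    c *ₗ k *ₗ v′    ≡⟨ cong (c *ₗ_) k*v′≡w·v ⟩
    c *ₗ (w · v)    ≡⟨ sym (·-*ₗ c w v) ⟩
    w · (c *ₗ v)    ∎
    where open ≡-Reasoning

  im[v·p̄]*im[v·p] : ∀ p v → im (v · conj p) * im (v · p) ≡ norm p * (im v * im v) - norm v * (im p * im p)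
  im[v·p̄]*im[v·p] (a , b) (x , y) = identity (+ d) a b x y
    where
    identity : ∀ D a b x y → (x * - b + y * a) * (x * b + y * a) ≡ (a * a + D * (b * b)) * (y * y) - (x * x + D * (y * y)) * (b * b)
    identity = solve-∀

  im[v·p]-im[v·p̄] : ∀ p v → im (v · p) - im (v · conj p) ≡ + 2 * (re v * im p)
  im[v·p]-im[v·p̄] (a , b) (x , y) = identity a b x y
    where
    identity : ∀ a b x y → (x * b + y * a) - (x * - b + y * a) ≡ + 2 * (x * b)
    identity = solve-∀

  ∣-re : ∀ {c m} w → norm w ≡ + (m ℕ.* m) → c ℕ.∣ m → + c ∣ im w → + c ∣ re w
  ∣-re w w-rep c∣m c∣im-w =
    ∣ᵤ⇒∣ (∣-sumOfSquares d (+-injective (trans (sym w-rep) (norm≡normℕ w))) c∣m (∣⇒∣ᵤ c∣im-w))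

  -- Multiplied by im q, both components of v′ · conj v are combinations of im (v · q) and of the
  -- components of v′ · q, so c divides them once im q is cancelled.
  ∣-·conj : ∀ {c m} q v v′ → norm q ≡ + m → norm v′ ≡ + m → c ℕ.∣ m → Coprime c ∣ im q ∣ →
            + c ∣ im (v · q) → + c ∣ im (v′ · q) → (+ c ∣ re (v′ · conj v)) × (+ c ∣ im (v′ · conj v))
  ∣-·conj {c} {m} q@(q₁ , q₂) v@(x , y) v′@(x′ , y′) q-rep v′-rep c∣m c⊥q₂ c∣im[vq] c∣im[v′q] =
    cancel (identity₁ (+ d) q₁ q₂ x y x′ y′) (ℤ.∣m∣n⇒∣m-n (ℤ.∣n⇒∣m*n x′ c∣im[vq]) (ℤ.∣n⇒∣m*n y c∣re[v′q])) ,
    cancel (identity₂ q₁ q₂ x y x′ y′) (ℤ.∣m∣n⇒∣m-n (ℤ.∣n⇒∣m*n y′ c∣im[vq]) (ℤ.∣n⇒∣m*n y c∣im[v′q]))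
    where
    identity₁ : ∀ D q₁ q₂ x y x′ y′ →
                q₂ * (x′ * x - D * (y′ * - y)) ≡ x′ * (x * q₂ + y * q₁) - y * (x′ * q₁ - D * (y′ * q₂))
    identity₁ = solve-∀
    identity₂ : ∀ q₁ q₂ x y x′ y′ →
                q₂ * (x′ * - y + y′ * x) ≡ y′ * (x * q₂ + y * q₁) - y * (x′ * q₂ + y′ * q₁)
    identity₂ = solve-∀
    c∣re[v′q] : + c ∣ re (v′ · q)
    c∣re[v′q] = ∣-re (v′ · q) (trans (norm-· v′ q) (trans (cong₂ _*_ v′-rep q-rep) (sym (pos-* m m)))) c∣m c∣im[v′q]
    cancel : ∀ {z r} → q₂ * z ≡ r → + c ∣ r → + c ∣ z
    cancel refl c∣r = coprime-∣-cancelˡ {a = q₂} c⊥q₂ c∣r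

  module Fibre {m} .{{_ : NonZero m}} (p v : ℤ²) (p-rep : norm p ≡ + m) (v-rep : norm v ≡ + m)
               (im-p⊥m : Coprime ∣ im p ∣ m) where

    e : ℕ
    e = gcd m ∣ im (v · conj p) ∣

    instance
      e≢0 : NonZero e
      e≢0 = ℕ.≢-nonZero (gcd[m,n]≢0 m _ (inj₁ (ℕ.≢-nonZero⁻¹ m)))

    k l : ℕ
    k = gcd e (m / e)
    l = lcm e (m / e)

    e∣m : e ℕ.∣ m
    e∣m = gcd[m,n]∣m m _

    m/e∣m : m / e ℕ.∣ m
    m/e∣m = m/n∣m e∣m

    k*l≡m : k ℕ.* l ≡ m
    k*l≡m = trans (gcd*lcm e (m / e)) (m*[n/m]≡n e∣m)

    instance
      k*l≢0 : NonZero (k ℕ.* l)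
      k*l≢0 = subst NonZero (sym k*l≡m) (ℕ.≢-nonZero (ℕ.≢-nonZero⁻¹ m))
      k≢0 : NonZero k
      k≢0 = ℕ.m*n≢0⇒m≢0 k
      l≢0 : NonZero l
      l≢0 = ℕ.m*n≢0⇒n≢0 k

    coprime-im-p : ∀ {c} → c ℕ.∣ m → Coprime c ∣ im p ∣
    coprime-im-p c∣m = coprime-∣ˡ c∣m (coprime-sym im-p⊥m)

    e∣im : ∀ v′ → gcd m ∣ im (v′ · conj p) ∣ ≡ e → + e ∣ im (v′ · conj p)
    e∣im v′ v′-e = ∣ᵤ⇒∣ (subst (ℕ._∣ _) v′-e (gcd[m,n]∣n m _))

    m/e∣im : ∀ v′ → norm v′ ≡ + m → gcd m ∣ im (v′ · conj p) ∣ ≡ e → + (m / e) ∣ im (v′ · p)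
    m/e∣im v′ v′-rep v′-e = ∣ᵤ⇒∣ (/gcd-∣ v′-e m∣product)
      where
      factor : ∀ M a b → M * a - M * b ≡ M * (a - b)
      factor = solve-∀
      product≡ : im (v′ · conj p) * im (v′ · p) ≡ + m * (im v′ * im v′ - im p * im p)
      product≡ = trans (im[v·p̄]*im[v·p] p v′)
                   (trans (cong₂ (λ s t → s * (im v′ * im v′) - t * (im p * im p)) p-rep v′-rep) (factor (+ m) _ _))
      m∣product : m ℕ.∣ ∣ im (v′ · conj p) ∣ ℕ.* ∣ im (v′ · p) ∣
      m∣product = subst (m ℕ.∣_) (abs-* (im (v′ · conj p)) (im (v′ · p)))
                    (∣⇒∣ᵤ (subst (+ m ∣_) (sym product≡) (ℤ.∣m⇒∣m*n _ ℤ.∣-refl)))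

    l∣v′·v̄ : ∀ v′ → norm v′ ≡ + m → gcd m ∣ im (v′ · conj p) ∣ ≡ e →
             (+ l ∣ re (v′ · conj v)) × (+ l ∣ im (v′ · conj v))
    l∣v′·v̄ v′ v′-rep v′-e =
      lcm-∣ (proj₁ e∣v′·v̄) (proj₁ m/e∣v′·v̄) , lcm-∣ (proj₂ e∣v′·v̄) (proj₂ m/e∣v′·v̄)
      where
      e∣v′·v̄ : (+ e ∣ re (v′ · conj v)) × (+ e ∣ im (v′ · conj v))
      e∣v′·v̄ = ∣-·conj (conj p) v v′ (trans (norm-conj p) p-rep) v′-rep e∣m
                 (subst (Coprime e) (sym (∣-i∣≡∣i∣ (im p))) (coprime-im-p e∣m)) (e∣im v refl) (e∣im v′ v′-e)
      m/e∣v′·v̄ : (+ (m / e) ∣ re (v′ · conj v)) × (+ (m / e) ∣ im (v′ · conj v))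
      m/e∣v′·v̄ = ∣-·conj p v v′ p-rep v′-rep m/e∣m (coprime-im-p m/e∣m)
                   (m/e∣im v v-rep refl) (m/e∣im v′ v′-rep v′-e)
      lcm-∣ : ∀ {z} → + e ∣ z → + (m / e) ∣ z → + l ∣ z
      lcm-∣ e∣z m/e∣z = ∣ᵤ⇒∣ (lcm-least (∣⇒∣ᵤ e∣z) (∣⇒∣ᵤ m/e∣z))

    ∃[w]k*v′≡w·v : ∀ v′ → norm v′ ≡ + m → gcd m ∣ im (v′ · conj p) ∣ ≡ e →
                   ∃[ w ] norm w ≡ + (k ℕ.* k) × + k *ₗ v′ ≡ w · v
    ∃[w]k*v′≡w·v v′ v′-rep v′-e = w , norm-w , k*v′≡w·v
      where
      open ≡-Reasoning
      ζ w : ℤ²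
      ζ = v′ · conj v
      w = (re ζ ÷ l , im ζ ÷ l)
      l*w≡ζ : + l *ₗ w ≡ ζ
      l*w≡ζ = let l∣re , l∣im = l∣v′·v̄ v′ v′-rep v′-e
              in cong₂ _,_ (÷-exact _ (∣⇒∣ᵤ l∣re)) (÷-exact _ (∣⇒∣ᵤ l∣im))
      regroup : ∀ k l → (k ℕ.* l) ℕ.* (k ℕ.* l) ≡ (l ℕ.* l) ℕ.* (k ℕ.* k)
      regroup = ℕ-Solver.solve-∀
      norm-w : norm w ≡ + (k ℕ.* k)
      norm-w = *-cancelˡ-≡ (+ (l ℕ.* l)) _ _ {{ℕ.m*n≢0 l l}} (begin
        + (l ℕ.* l) * norm w          ≡⟨ cong (_* norm w) (pos-* l l) ⟩
        + l * + l * norm w            ≡⟨ sym (norm-*ₗ (+ l) w) ⟩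
        norm (+ l *ₗ w)               ≡⟨ cong norm l*w≡ζ ⟩
        norm ζ                        ≡⟨ norm-· v′ (conj v) ⟩
        norm v′ * norm (conj v)       ≡⟨ cong₂ _*_ v′-rep (trans (norm-conj v) v-rep) ⟩
        + m * + m                     ≡⟨ sym (pos-* m m) ⟩
        + (m ℕ.* m)                   ≡⟨ cong (λ t → + (t ℕ.* t)) (sym k*l≡m) ⟩
        + ((k ℕ.* l) ℕ.* (k ℕ.* l))   ≡⟨ cong +_ (regroup k l) ⟩
        + ((l ℕ.* l) ℕ.* (k ℕ.* k))   ≡⟨ pos-* (l ℕ.* l) (k ℕ.* k) ⟩
        + (l ℕ.* l) * + (k ℕ.* k)     ∎)
      l*k≡norm-v : + l * + k ≡ norm v
      l*k≡norm-v = trans (sym (pos-* l k)) (trans (cong +_ (trans (ℕ.*-comm l k) k*l≡m)) (sym v-rep))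
      k*v′≡w·v : + k *ₗ v′ ≡ w · v
      k*v′≡w·v = *ₗ-cancel l (begin
        + l *ₗ + k *ₗ v′              ≡⟨ *ₗ-*ₗ (+ l) (+ k) v′ ⟩
        (+ l * + k) *ₗ v′             ≡⟨ cong (_*ₗ v′) l*k≡norm-v ⟩
        norm v *ₗ v′                  ≡⟨ sym (·-conj-· v′ v) ⟩
        ζ · v                         ≡⟨ cong (_· v) (sym l*w≡ζ) ⟩
        (+ l *ₗ w) · v                ≡⟨ *ₗ-· (+ l) w v ⟩
        + l *ₗ (w · v)                ∎)

    k*k∣4d : Coprime ∣ im v ∣ m → k ℕ.* k ℕ.∣ 4 ℕ.* d
    k*k∣4d im-v⊥m =
      square∣sumOfSquares⇒square∣4* {x = ∣ re v ∣} d (coprime-∣ˡ k∣m (coprime-sym im-v⊥m)) k∣2x k*k∣N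
      where
      k∣e : k ℕ.∣ e
      k∣e = gcd[m,n]∣m e (m / e)
      k∣m/e : k ℕ.∣ m / e
      k∣m/e = gcd[m,n]∣n e (m / e)
      k∣m : k ℕ.∣ m
      k∣m = ℕ.∣-trans k∣e e∣m
      regroup : ∀ x q → + 2 * (x * q) ≡ q * (+ 2 * x)
      regroup = solve-∀
      k∣im-p*2x : + k ∣ im p * (+ 2 * re v)
      k∣im-p*2x = subst (+ k ∣_) (trans (im[v·p]-im[v·p̄] p v) (regroup (re v) (im p)))
                    (ℤ.∣m∣n⇒∣m-n (ℤ.∣-trans (∣ᵤ⇒∣ k∣m/e) (m/e∣im v v-rep refl))
                                 (ℤ.∣-trans (∣ᵤ⇒∣ k∣e) (e∣im v refl)))
      k∣2x : k ℕ.∣ 2 ℕ.* ∣ re v ∣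
      k∣2x = subst (k ℕ.∣_) (abs-* (+ 2) (re v)) (∣⇒∣ᵤ (coprime-∣-cancelˡ {a = im p} (coprime-im-p k∣m) k∣im-p*2x))
      k*k∣N : k ℕ.* k ℕ.∣ normℕ v
      k*k∣N = subst (k ℕ.* k ℕ.∣_) (trans (m*[n/m]≡n e∣m) (+-injective (trans (sym v-rep) (norm≡normℕ v))))
                (ℕ.*-pres-∣ k∣e k∣m/e)

module NormSquares where

  open Naturals using (m*m≡n*n⇒m≡n)

  open import Data.Nat as ℕ using (zero; suc; _≤_; NonZero; z≤n; s≤s)
  import Data.Nat.Properties as ℕ
  open import Data.Integer using (ℤ; +_; -_; ∣_∣; -[1+_])
  open import Data.Integer.Properties using (∣i∣≡0⇒i≡0)
  open import Data.List using (List; []; _∷_; _++_; length)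
  open import Data.List.Membership.Propositional using (_∈_)
  open import Data.List.Membership.Propositional.Properties using (∈-++⁺ˡ; ∈-++⁺ʳ)
  open import Data.List.Relation.Unary.Any using (here; there)
  open import Data.Product using (_×_; _,_)
  open import Data.Sum using (_⊎_; inj₁; inj₂)
  open import Relation.Binary.PropositionalEquality using (_≡_; _≢_; refl; sym; trans; cong)
  open import Relation.Nullary.Negation using (contradiction)

  ±ˡ ±ʳ : ℕ → List (ℤ × ℤ)
  ±ˡ n = (+ n , + 0) ∷ (- + n , + 0) ∷ []
  ±ʳ n = (+ 0 , + n) ∷ (+ 0 , - + n) ∷ []

  ±± : List (ℤ × ℤ)
  ±± = (+ 1 , + 1) ∷ (+ 1 , - + 1) ∷ (- + 1 , + 1) ∷ (- + 1 , - + 1) ∷ []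

  ∣∣≡⇒± : ∀ {a n} → ∣ a ∣ ≡ n → a ≡ + n ⊎ a ≡ - + n
  ∣∣≡⇒± {+ n} refl = inj₁ refl
  ∣∣≡⇒± { -[1+ n ]} refl = inj₂ refl

  ∈-±ˡ : ∀ {a b n} → ∣ a ∣ ≡ n → b ≡ + 0 → (a , b) ∈ ±ˡ n
  ∈-±ˡ {a} |a|≡n refl with ∣∣≡⇒± {a} |a|≡n
  ... | inj₁ refl = here refl
  ... | inj₂ refl = there (here refl)

  ∈-±ʳ : ∀ {a b n} → a ≡ + 0 → ∣ b ∣ ≡ n → (a , b) ∈ ±ʳ n
  ∈-±ʳ {b = b} refl |b|≡n with ∣∣≡⇒± {b} |b|≡n
  ... | inj₁ refl = here refl
  ... | inj₂ refl = there (here refl)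

  ∈-±± : ∀ {a b} → ∣ a ∣ ≡ 1 → ∣ b ∣ ≡ 1 → (a , b) ∈ ±±
  ∈-±± {a} {b} |a|≡1 |b|≡1 with ∣∣≡⇒± {a} |a|≡1 | ∣∣≡⇒± {b} |b|≡1
  ... | inj₁ refl | inj₁ refl = here refl
  ... | inj₁ refl | inj₂ refl = there (here refl)
  ... | inj₂ refl | inj₁ refl = there (there (here refl))
  ... | inj₂ refl | inj₂ refl = there (there (there (here refl)))

  -- Every (a , b) with b ≠ 0 and a² + d b² ∈ {1 , 4}; both norms share one list, so it depends on d alone.
  offAxis : ℕ → List (ℤ × ℤ)
  offAxis 0 = []
  offAxis 1 = ±ʳ 1 ++ ±ʳ 2
  offAxis 2 = []
  offAxis 3 = ±±
  offAxis 4 = ±ʳ 1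
  offAxis (suc (suc (suc (suc (suc _))))) = []

  length-offAxis : ∀ d → length (offAxis d) ≤ 4
  length-offAxis 0 = z≤n
  length-offAxis 1 = ℕ.≤-refl
  length-offAxis 2 = z≤n
  length-offAxis 3 = ℕ.≤-refl
  length-offAxis 4 = ℕ.m≤n+m 2 2
  length-offAxis (suc (suc (suc (suc (suc _))))) = z≤n

  ofNormSquare : ℕ → ℕ → List (ℤ × ℤ)
  ofNormSquare k d = ±ˡ k ++ offAxis d

  length-ofNormSquare : ∀ k d → length (ofNormSquare k d) ≤ 6
  length-ofNormSquare k d = s≤s (s≤s (length-offAxis d))

  private
    square-mono : ∀ {m n} → m ≤ n → m ℕ.* m ≤ n ℕ.* n
    square-mono m≤n = ℕ.*-mono-≤ m≤n m≤n

    d*y≡n⇒y≤n : ∀ {d y n} .{{_ : NonZero d}} → d ℕ.* y ≡ n → y ≤ n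
    d*y≡n⇒y≤n {d} {y} eq = ℕ.≤-trans (ℕ.m≤n*m y d) (ℕ.≤-reflexive eq)

    d*[1+b]²≢0 : ∀ d b .{{_ : NonZero d}} → d ℕ.* (suc b ℕ.* suc b) ≢ 0
    d*[1+b]²≢0 d b = ℕ.≢-nonZero⁻¹ _ {{ℕ.m*n≢0 d (suc b ℕ.* suc b)}}

  ∈-offAxis : ∀ {d k B} .{{_ : NonZero d}} a b → ∣ b ∣ ≡ suc B → k ≡ 1 ⊎ k ≡ 2 →
              ∣ a ∣ ℕ.* ∣ a ∣ ℕ.+ d ℕ.* (suc B ℕ.* suc B) ≡ k ℕ.* k → (a , b) ∈ offAxis d
  ∈-offAxis {d} {k} {B} a b |b|≡1+B k≡1∨2 eq with ∣ a ∣ in |a|≡ | k≡1∨2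
  ... | zero | inj₁ refl
    with refl ← ℕ.m*n≡1⇒m≡1 d _ eq | refl ← ℕ.m*n≡1⇒m≡1 (suc B) (suc B) (ℕ.m*n≡1⇒n≡1 d _ eq) =
    ∈-++⁺ˡ (∈-±ʳ (∣i∣≡0⇒i≡0 |a|≡) |b|≡1+B)
  ... | suc A | inj₁ refl = contradiction (ℕ.m+n≡0⇒n≡0 (A ℕ.+ A ℕ.* suc A) (ℕ.suc-injective eq)) (d*[1+b]²≢0 d B)
  ... | zero | inj₂ refl with B
  ...   | zero with refl ← trans (sym (ℕ.*-identityʳ d)) eq = ∈-±ʳ (∣i∣≡0⇒i≡0 |a|≡) |b|≡1+B
  ...   | suc zero with refl ← ℕ.*-cancelʳ-≡ d 1 4 eq = ∈-++⁺ʳ (±ʳ 1) (∈-±ʳ (∣i∣≡0⇒i≡0 |a|≡) |b|≡1+B)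
  ...   | suc (suc B′) =
    contradiction (ℕ.≤-trans (square-mono (ℕ.m≤m+n 3 B′)) (d*y≡n⇒y≤n eq)) (ℕ.<⇒≱ (ℕ.m≤m+n 5 4))
  ∈-offAxis {d} {k} {B} a b |b|≡1+B k≡1∨2 eq | suc zero | inj₂ refl with B
  ...   | zero with refl ← trans (sym (ℕ.*-identityʳ d)) (ℕ.suc-injective eq) = ∈-±± |a|≡ |b|≡1+B
  ...   | suc B′ =
    contradiction (ℕ.≤-trans (square-mono (ℕ.m≤m+n 2 B′)) (d*y≡n⇒y≤n (ℕ.suc-injective eq))) (ℕ.<⇒≱ ℕ.≤-refl)
  ∈-offAxis {d} {k} {B} a b |b|≡1+B k≡1∨2 eq | suc (suc zero) | inj₂ refl =
    contradiction (ℕ.+-cancelˡ-≡ 4 _ 0 eq) (d*[1+b]²≢0 d B)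
  ∈-offAxis {d} {k} {B} a b |b|≡1+B k≡1∨2 eq | suc (suc (suc A)) | inj₂ refl =
    contradiction (ℕ.≤-trans (square-mono (ℕ.m≤m+n 3 A)) (ℕ.m+n≤o⇒m≤o _ (ℕ.≤-reflexive eq))) (ℕ.<⇒≱ (ℕ.m≤m+n 5 4))

  ∈-ofNormSquare : ∀ {d k} .{{_ : NonZero d}} a b → k ≡ 1 ⊎ k ≡ 2 →
                   ∣ a ∣ ℕ.* ∣ a ∣ ℕ.+ d ℕ.* (∣ b ∣ ℕ.* ∣ b ∣) ≡ k ℕ.* k → (a , b) ∈ ofNormSquare k d
  ∈-ofNormSquare {d} {k} a b k≡1∨2 eq with ∣ b ∣ in |b|≡
  ... | zero = ∈-++⁺ˡ (∈-±ˡ (m*m≡n*n⇒m≡n _ k |a|²≡k²) (∣i∣≡0⇒i≡0 |b|≡))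
    where
    |a|²≡k² : ∣ a ∣ ℕ.* ∣ a ∣ ≡ k ℕ.* k
    |a|²≡k² = trans (sym (ℕ.+-identityʳ _)) (trans (cong (ℕ._+_ (∣ a ∣ ℕ.* ∣ a ∣)) (sym (ℕ.*-zeroʳ d))) eq)
  ... | suc B = ∈-++⁺ʳ (±ˡ k) (∈-offAxis a b |b|≡ k≡1∨2 eq)

module Counting where

  open import Defs using (window; r; τ)
  open Lists
  open Naturals
  open Integers
  open NormSquares

  open import Data.Nat as ℕ using (suc; _≤_; NonZero)
  import Data.Nat.Properties as ℕ
  open import Data.Nat.Divisibility as ℕ using (_∣?_)
  open import Data.Nat.GCD using (gcd; gcd[m,n]∣m; gcd[m,n]∣n; gcd[m,n]≢0)
  open import Data.Nat.Coprimality using (Coprime; coprime-/gcd)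
  open import Data.Integer using (ℤ; +_; _+_; _*_; _-_; ∣_∣)
  open import Data.Integer.Properties using (+-injective; pos-*; *-assoc) renaming (_≟_ to _≟ℤ_)
  open import Data.Integer.Tactic.RingSolver using (solve-∀)
  open import Data.List using (List; map; filter; upTo; cartesianProduct; length; head)
  open import Data.List.Properties using (length-map)
  open import Data.List.Membership.Propositional using (_∈_)
  open import Data.List.Membership.Propositional.Properties
    using (∈-filter⁺; ∈-filter⁻; ∈-map⁺; ∈-upTo⁺; ∈-cartesianProduct⁺)
  open import Data.List.Relation.Unary.Unique.Propositional using (Unique)
  open import Data.List.Relation.Unary.Unique.Propositional.Properties using (filter⁺; map⁺; upTo⁺; cartesianProduct⁺)
  open import Data.Maybe using (maybe)
  open import Data.Product using (∃-syntax; _×_; _,_; proj₁; proj₂)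
  open import Data.Product.Properties using (≡-dec)
  open import Data.Sum using (_⊎_; inj₁)
  open import Function using (_∘_)
  open import Relation.Binary.PropositionalEquality

  window-unique : ∀ n → Unique (window n)
  window-unique n = map⁺ -n-injective (upTo⁺ _)
    where
    cancel : ∀ a b → a - b + b ≡ a
    cancel = solve-∀
    -n-injective : ∀ {i j} → + i - + n ≡ + j - + n → i ≡ j
    -n-injective {i} {j} eq = +-injective (trans (sym (cancel (+ i) (+ n))) (trans (cong (_+ + n) eq) (cancel (+ j) (+ n))))

  divisors : ℕ → List ℕ
  divisors n = filter (_∣? n) (map suc (upTo n))

  ∈-divisors : ∀ {n c} .{{_ : NonZero n}} .{{_ : NonZero c}} → c ℕ.∣ n → c ∈ divisors n
  ∈-divisors {n} {suc c} c∣n = ∈-filter⁺ (_∣? n) (∈-map⁺ suc (∈-upTo⁺ (ℕ.∣⇒≤ c∣n))) c∣n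

  solutions : ℕ → ℕ → List (ℤ × ℤ)
  solutions n α = filter (λ u → + n ≟ℤ ℤ[√-d].norm α u) (cartesianProduct (window n) (window n))

  solutions-unique : ∀ n α → Unique (solutions n α)
  solutions-unique n α = filter⁺ (λ u → + n ≟ℤ ℤ[√-d].norm α u) (cartesianProduct⁺ (window-unique n) (window-unique n))

  ∈-solutions⁻ : ∀ {n α u} → u ∈ solutions n α → + n ≡ ℤ[√-d].norm α u
  ∈-solutions⁻ {n} {α} =
    proj₂ ∘ ∈-filter⁻ (λ u → + n ≟ℤ ℤ[√-d].norm α u) {xs = cartesianProduct (window n) (window n)}

  module _ (n : ℕ) .{{_ : NonZero n}} {α d f : ℕ} .{{_ : NonZero α}}
           (α≡d*f² : α ≡ d ℕ.* (f ℕ.* f)) (d-sqf : SquareFree d) where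

    open ℤ[√-d] d

    instance
      d*f²≢0 : NonZero (d ℕ.* (f ℕ.* f))
      d*f²≢0 = subst NonZero α≡d*f² (ℕ.≢-nonZero (ℕ.≢-nonZero⁻¹ α))
      d≢0 : NonZero d
      d≢0 = ℕ.m*n≢0⇒m≢0 d
      f≢0 : NonZero f
      f≢0 = ℕ.m*n≢0⇒m≢0 f {{ℕ.m*n≢0⇒n≢0 d}}

    S : List ℤ²
    S = solutions n α

    lift : ℤ² → ℤ²
    lift (x , y) = (x , + f * y)

    unlift : ℕ → ℤ² → ℤ²
    unlift k (x , y) = (x ÷ k , y ÷ (k ℕ.* f))

    -- Opaque, so that conversion checking never unfolds gcd.
    opaque
      g : ℤ² → ℕ
      g u = gcd ∣ re (lift u) ∣ ∣ im (lift u) ∣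

      reduced : ℤ² → ℤ²
      reduced u = (re (lift u) ÷ g u , im (lift u) ÷ g u)

      g*reduced : ∀ u → + g u *ₗ reduced u ≡ lift u
      g*reduced u = cong₂ _,_ (÷-exact _ (gcd[m,n]∣m ∣ re (lift u) ∣ ∣ im (lift u) ∣))
                              (÷-exact _ (gcd[m,n]∣n ∣ re (lift u) ∣ ∣ im (lift u) ∣))

      reduced-primitive : ∀ u .{{_ : NonZero (g u)}} → Coprime ∣ re (reduced u) ∣ ∣ im (reduced u) ∣
      reduced-primitive u = subst₂ Coprime (sym (abs-÷ (g u) _)) (sym (abs-÷ (g u) _))
                              (coprime-/gcd ∣ re (lift u) ∣ ∣ im (lift u) ∣)

    m : ℤ² → ℕ
    m u = normℕ (reduced u)

    opaque
      -- The fallback (+ 0 , + 0) is never used: u ∈ S is itself a candidate for g u.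
      representative : ℕ → ℤ²
      representative G = maybe reduced (+ 0 , + 0) (head (filter (λ s → g s ℕ.≟ G) S))

      representative-spec : ∀ {u} → u ∈ S → ∃[ s ] s ∈ S × g s ≡ g u × representative (g u) ≡ reduced s
      representative-spec {u} u∈S with s , head≡s , s∈ ← ∈⇒head≡just (∈-filter⁺ (λ s → g s ℕ.≟ g u) u∈S refl) =
        let s∈S , g-s≡g-u = ∈-filter⁻ (λ s → g s ℕ.≟ g u) {xs = S} s∈
        in s , s∈S , g-s≡g-u , cong (maybe reduced (+ 0 , + 0)) head≡s

    opaque
      e : ℤ² → ℕ
      e u = gcd (m u) ∣ im (reduced u · conj (representative (g u))) ∣

      e≡gcd : ∀ u → e u ≡ gcd (m u) ∣ im (reduced u · conj (representative (g u))) ∣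
      e≡gcd u = refl

    code : ℤ² → ℕ × ℕ
    code u = g u , e u

    norm-lift : ∀ {u} → u ∈ S → norm (lift u) ≡ + n
    norm-lift {x , y} u∈S =
      trans (sym (regroup (+ d) (+ f) x y))
            (trans (cong (λ a → x * x + a * (y * y)) (sym α≡)) (sym (∈-solutions⁻ {n} {α} u∈S)))
      where
      α≡ : + α ≡ + d * (+ f * + f)
      α≡ = trans (cong +_ α≡d*f²) (trans (pos-* d _) (cong (+ d *_) (pos-* f f)))
      regroup : ∀ D F x y → x * x + (D * (F * F)) * (y * y) ≡ x * x + D * ((F * y) * (F * y))
      regroup = solve-∀

    unlift-*ₗ-lift : ∀ k .{{_ : NonZero k}} u → unlift k (+ k *ₗ lift u) ≡ u
    unlift-*ₗ-lift k (x , y) =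
      cong₂ _,_ (*-÷ k x) (trans (cong (_÷ (k ℕ.* f)) k*[f*y]≡[k*f]*y) (*-÷ (k ℕ.* f) {{ℕ.m*n≢0 k f}} y))
      where
      k*[f*y]≡[k*f]*y : + k * (+ f * y) ≡ + (k ℕ.* f) * y
      k*[f*y]≡[k*f]*y = trans (sym (*-assoc (+ k) (+ f) y)) (cong (_* y) (sym (pos-* k f)))

    norm-reduced : ∀ u → norm (reduced u) ≡ + m u
    norm-reduced u = norm≡normℕ (reduced u)

    n≡g*g*m : ∀ {u} → u ∈ S → n ≡ g u ℕ.* g u ℕ.* m u
    n≡g*g*m {u} u∈S = +-injective (begin
      + n                                ≡⟨ sym (norm-lift u∈S) ⟩
      norm (lift u)                      ≡⟨ cong norm (sym (g*reduced u)) ⟩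
      norm (+ g u *ₗ reduced u)          ≡⟨ norm-*ₗ (+ g u) (reduced u) ⟩
      + g u * + g u * norm (reduced u)   ≡⟨ cong₂ _*_ (sym (pos-* (g u) (g u))) (norm-reduced u) ⟩
      + (g u ℕ.* g u) * + m u            ≡⟨ sym (pos-* (g u ℕ.* g u) (m u)) ⟩
      + (g u ℕ.* g u ℕ.* m u)            ∎)
      where open ≡-Reasoning

    g*g*m≢0 : ∀ {u} → u ∈ S → NonZero (g u ℕ.* g u ℕ.* m u)
    g*g*m≢0 u∈S = subst NonZero (n≡g*g*m u∈S) (ℕ.≢-nonZero (ℕ.≢-nonZero⁻¹ n))

    g*g≢0 : ∀ {u} → u ∈ S → NonZero (g u ℕ.* g u)
    g*g≢0 {u} u∈S = ℕ.m*n≢0⇒m≢0 (g u ℕ.* g u) {{g*g*m≢0 u∈S}}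

    g≢0 : ∀ {u} → u ∈ S → NonZero (g u)
    g≢0 {u} u∈S = ℕ.m*n≢0⇒m≢0 (g u) {{g*g≢0 u∈S}}

    m≢0 : ∀ {u} → u ∈ S → NonZero (m u)
    m≢0 {u} u∈S = ℕ.m*n≢0⇒n≢0 (g u ℕ.* g u) {{g*g*m≢0 u∈S}}

    m-cong : ∀ {u u′} → u ∈ S → u′ ∈ S → g u ≡ g u′ → m u ≡ m u′
    m-cong {u} {u′} u∈S u′∈S g≡ = ℕ.*-cancelˡ-≡ (m u) (m u′) (g u ℕ.* g u) {{g*g≢0 u∈S}}
      (trans (sym (n≡g*g*m u∈S)) (trans (n≡g*g*m u′∈S) (cong (λ G → G ℕ.* G ℕ.* m u′) (sym g≡))))

    reduced-coprime : ∀ {u} → u ∈ S → Coprime ∣ im (reduced u) ∣ (m u)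
    reduced-coprime {u} u∈S = coprime-sumOfSquares d (reduced-primitive u {{g≢0 u∈S}})

    representative-rep : ∀ {u} → u ∈ S → norm (representative (g u)) ≡ + m u
    representative-rep u∈S with s , s∈S , g-s≡g-u , rep≡ ← representative-spec u∈S =
      trans (cong norm rep≡) (trans (norm-reduced s) (cong +_ (m-cong s∈S u∈S g-s≡g-u)))

    representative-coprime : ∀ {u} → u ∈ S → Coprime ∣ im (representative (g u)) ∣ (m u)
    representative-coprime u∈S with s , s∈S , g-s≡g-u , rep≡ ← representative-spec u∈S =
      subst₂ (λ q M → Coprime ∣ im q ∣ M) (sym rep≡) (m-cong s∈S u∈S g-s≡g-u) (reduced-coprime s∈S)

    code∈ : ∀ {u} → u ∈ S → code u ∈ cartesianProduct (divisors n) (divisors n)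
    code∈ {u} u∈S = ∈-cartesianProduct⁺ (∈-divisors g∣n) (∈-divisors e∣n)
      where
      instance
        _ = g≢0 u∈S
        e≢0 : NonZero (e u)
        e≢0 = subst NonZero (sym (e≡gcd u))
                (ℕ.≢-nonZero (gcd[m,n]≢0 (m u) _ (inj₁ (ℕ.≢-nonZero⁻¹ (m u) {{m≢0 u∈S}}))))
      g∣n : g u ℕ.∣ n
      g∣n = subst (g u ℕ.∣_) (sym (n≡g*g*m u∈S)) (ℕ.∣-trans (ℕ.m∣m*n (g u)) (ℕ.m∣m*n (m u)))
      e∣m : e u ℕ.∣ m u
      e∣m = subst (ℕ._∣ m u) (sym (e≡gcd u)) (gcd[m,n]∣m (m u) _)
      e∣n : e u ℕ.∣ n
      e∣n = subst (e u ℕ.∣_) (sym (n≡g*g*m u∈S)) (ℕ.∣-trans e∣m (ℕ.n∣m*n (g u ℕ.* g u)))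

    code≡⇒norm-reduced : ∀ {u u′} → u ∈ S → u′ ∈ S → code u′ ≡ code u → norm (reduced u′) ≡ + m u
    code≡⇒norm-reduced {u} {u′} u∈S u′∈S code≡ =
      trans (norm-reduced u′) (cong +_ (m-cong u′∈S u∈S (cong proj₁ code≡)))

    code≡⇒gcd≡gcd : ∀ {u u′} → u ∈ S → u′ ∈ S → code u′ ≡ code u →
                    gcd (m u) ∣ im (reduced u′ · conj (representative (g u))) ∣
                    ≡ gcd (m u) ∣ im (reduced u · conj (representative (g u))) ∣
    code≡⇒gcd≡gcd {u} {u′} u∈S u′∈S code≡ = begin
      gcd (m u) ∣ im (reduced u′ · conj (representative (g u))) ∣    ≡⟨ cong₂ (λ M G → gcd M ∣ im (reduced u′ · conj (representative G)) ∣)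
                                                                           (sym (m-cong u′∈S u∈S g≡)) (sym g≡) ⟩
      gcd (m u′) ∣ im (reduced u′ · conj (representative (g u′))) ∣  ≡⟨ sym (e≡gcd u′) ⟩
      e u′                                                            ≡⟨ cong proj₂ code≡ ⟩
      e u                                                             ≡⟨ e≡gcd u ⟩
      gcd (m u) ∣ im (reduced u · conj (representative (g u))) ∣      ∎
      where
      open ≡-Reasoning
      g≡ : g u′ ≡ g u
      g≡ = cong proj₁ code≡

    lift-ratio : ∀ {u u′ k w} → g u′ ≡ g u → k *ₗ reduced u′ ≡ w · reduced u → k *ₗ lift u′ ≡ w · lift u
    lift-ratio {u} {u′} {k} {w} g≡ k*v′≡w·v = begin
      k *ₗ lift u′                ≡⟨ cong (k *ₗ_) (sym (g*reduced u′)) ⟩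
      k *ₗ + g u′ *ₗ reduced u′   ≡⟨ cong (λ G → k *ₗ + G *ₗ reduced u′) g≡ ⟩
      k *ₗ + g u *ₗ reduced u′    ≡⟨ *ₗ-ratio (+ g u) k w (reduced u) (reduced u′) k*v′≡w·v ⟩
      w · (+ g u *ₗ reduced u)    ≡⟨ cong (w ·_) (g*reduced u) ⟩
      w · lift u                  ∎
      where open ≡-Reasoning

    fibre : ∀ {u} → u ∈ S → ∃[ L ] length L ≤ 6 × (∀ {u′} → u′ ∈ S → code u′ ≡ code u → u′ ∈ L)
    fibre {u} u∈S = map candidate (ofNormSquare k d) , length≤6 , u′∈L
      where
      instance _ = m≢0 u∈S
      open Fibre (representative (g u)) (reduced u) (representative-rep u∈S) (norm-reduced u) (representative-coprime u∈S)
        using (k; k≢0; k*k∣4d; ∃[w]k*v′≡w·v)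
      k≡1∨2 : k ≡ 1 ⊎ k ≡ 2
      k≡1∨2 = k*k∣4*d⇒k≡1∨k≡2 d-sqf (k*k∣4d (reduced-coprime u∈S))
      candidate : ℤ² → ℤ²
      candidate w = unlift k (w · lift u)
      length≤6 : length (map candidate (ofNormSquare k d)) ≤ 6
      length≤6 = subst (_≤ 6) (sym (length-map candidate (ofNormSquare k d))) (length-ofNormSquare k d)
      u′∈L : ∀ {u′} → u′ ∈ S → code u′ ≡ code u → u′ ∈ map candidate (ofNormSquare k d)
      u′∈L {u′} u′∈S code≡ =
        subst (_∈ map candidate (ofNormSquare k d)) candidate-w≡u′ (∈-map⁺ candidate w∈)
        where
        ratio : ∃[ w ] norm w ≡ + (k ℕ.* k) × + k *ₗ reduced u′ ≡ w · reduced u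
        ratio = ∃[w]k*v′≡w·v (reduced u′) (code≡⇒norm-reduced u∈S u′∈S code≡) (code≡⇒gcd≡gcd u∈S u′∈S code≡)
        w : ℤ²
        w = proj₁ ratio
        w∈ : w ∈ ofNormSquare k d
        w∈ = ∈-ofNormSquare {d} {k} (re w) (im w) k≡1∨2
               (+-injective (trans (sym (norm≡normℕ w)) (proj₁ (proj₂ ratio))))
        candidate-w≡u′ : candidate w ≡ u′
        candidate-w≡u′ =
          trans (cong (unlift k) (sym (lift-ratio {u} {u′} {+ k} {w} (cong proj₁ code≡) (proj₂ (proj₂ ratio)))))
                (unlift-*ₗ-lift k u′)

    length-solutions≤ : length S ≤ 6 ℕ.* (τ n ℕ.* τ n)
    length-solutions≤ = subst (λ t → length S ≤ 6 ℕ.* t) (length-cartesianProduct (divisors n) (divisors n))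
                          (length≤-fibres code (≡-dec ℕ._≟_ ℕ._≟_) _ (solutions-unique n α) code∈ fibre)

open import Defs using (r; τ)
open import Data.Nat using (_*_; _≤_; NonZero)
open import Data.Product using (_,_)
open Naturals using (squareFree-decomposition)

proposition5 : (α n : ℕ) → .{{NonZero α}} → .{{NonZero n}} →
               r n α ≤ 6 * (τ n * τ n)
proposition5 α n with d , f , α≡d*f² , d-sqf ← squareFree-decomposition α =
  Counting.length-solutions≤ n {f = f} α≡d*f² d-sqf
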